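{- If $G$ is a graph of order $n \ge 3$ with minimum degree $\delta(G) \ge 1$, then $\operatorname{fd}(G) \le n-2$. Moreover, this bound is sharp: there are infinitely many graphs $G$ with $\delta(G) \ge 1$ satisfying $\operatorname{fd}(G) = |V(G)| - 2$.
   Context: All graphs are finite and simple; $N(v)$ denotes the open neighborhood of $v$. For a graph $G=(V,E)$ and an integer $k \ge 1$, a $k$-fair dominating set is a dominating set $D \subseteq V$ such that $|N(v) \cap D| = k$ for every $v \in V \setminus D$ (the set $D = V$ qualifies vacuously). A fair dominating set (FD-set) is a set that is a $k$-fair dominating set for some $k \ge 1$. If $G$ has at least one edge, $\operatorname{fd}(G)$ is the minimum cardinality of an FD-set of $G$; by convention, $\operatorname{fd}(\overline{K_n}) = n$ for the edgeless graph on $n$ vertices. -}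

module Defs where

open import Data.Nat using (ℕ; _≤_; _≥_)
open import Data.Bool using (Bool; true; false)
open import Data.Fin using (Fin)
open import Data.Fin.Subset using (Subset; _∈_; _∉_; _∩_; ∣_∣)
open import Data.Vec using (tabulate)
open import Data.Product using (Σ; ∃; ∃-syntax; _×_)
open import Relation.Binary.PropositionalEquality using (_≡_)

record Graph (n : ℕ) : Set where
  field
    adj   : Fin n → Fin n → Bool
    sym   : ∀ u v → adj u v ≡ adj v u
    irefl : ∀ v → adj v v ≡ false

open Graph public

N : ∀ {n} → Graph n → Fin n → Subset n
N G v = tabulate (adj G v)

MinDeg≥1 : ∀ {n} → Graph n → Set
MinDeg≥1 {n} G = ∀ v → ∃[ u ] (adj G v u ≡ true)

Dominating : ∀ {n} → Graph n → Subset n → Set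
Dominating {n} G D = ∀ v → v ∉ D → ∃[ u ] (u ∈ D × adj G v u ≡ true)

KFairDom : ∀ {n} → Graph n → ℕ → Subset n → Set
KFairDom {n} G k D =
  1 ≤ k × Dominating G D × (∀ v → v ∉ D → ∣ N G v ∩ D ∣ ≡ k)

FairDom : ∀ {n} → Graph n → Subset n → Set
FairDom G D = ∃[ k ] KFairDom G k D

-- fd(G) = f : some FD-set has size f and every FD-set has size ≥ f
-- (only used for graphs with at least one edge, where fd is the minimum).
FdEq : ∀ {n} → Graph n → ℕ → Set
FdEq {n} G f = (∃[ D ] (FairDom G D × ∣ D ∣ ≡ f))
             × (∀ D → FairDom G D → f ≤ ∣ D ∣)

FdLe : ∀ {n} → Graph n → ℕ → Set
FdLe {n} G b = ∃[ D ] (FairDom G D × ∣ D ∣ ≤ b)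

-- Upper bound: degrees lie in {1, …, n − 1}, so two vertices x ≠ y share a degree d, and then
-- V ∖ {x, y} is a fair dominating set in which x and y both have d − [x ~ y] neighbours. This fails
-- only when d = 1 and x ~ y, i.e. xy is an isolated edge; a second pigeonhole, on the degrees of
-- the vertices other than x, then yields a pair that works.
--
-- Sharpness: on the labels 0, …, 2r (r ≥ 3) join 0 to r, and join distinct i, j ≥ 1 whenever
-- i + j ≥ 2r + 1. Away from 0 and r this is a threshold graph, whose neighbourhoods are nested by
-- label; a fair set D cannot leave out two vertices whose D-neighbourhoods are strictly nested.
-- Splitting on whether 0 and r lie in D, this leaves at most two vertices outside D.
module Submission where

open import Defs hiding (sym)
open import Data.Empty using (⊥; ⊥-elim)
open import Data.Bool using (true; false)
open import Data.Nat using (ℕ; zero; suc; _≤_; _<_; _∸_; _+_; z≤n; s≤s; _≟_; _≤?_)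
open import Data.Nat.Properties
open import Data.Fin using (Fin; zero; suc; toℕ; fromℕ<) renaming (_≟_ to _≟ᶠ_)
open import Data.Fin.Properties
  using (pigeonhole; toℕ-fromℕ<; toℕ-injective; toℕ≤pred[n]; toℕ<n) renaming (<⇒≢ to <⇒≢ᶠ)
open import Data.Fin.Subset
  using (Subset; _∈_; _∉_; _∩_; _∪_; ∣_∣; ⁅_⁆; ⊤; ∁; _⊆_; _-_; Nonempty)
open import Data.Fin.Subset.Properties
  using (_∈?_; p⊂q⇒∣p∣<∣q∣; p⊆q⇒∣p∣≤∣q∣; p∩q⊆p; p∩q⊆q; x∈p∩q⁺; x∈p∩q⁻; ∣p∩q∣≤∣p∣; x∈p∪q⁺; x∈p∪q⁻;
         p⊆p∪q; q⊆p∪q; ∪-comm; x∈⁅x⁆; x∈⁅y⁆⇒x≡y; ∣⁅x⁆∣≡1; ∣⊤∣≡n; ∈⊤; nonempty?;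
         ∣∁p∣≡n∸∣p∣; x∉∁p⇒x∈p; x∉p⇒x∈∁p; x∈p⇒x∉∁p; x∈∁p⇒x∉p; x∈p∧x≢y⇒x∈p-y; x∈p⇒∣p-x∣<∣p∣)
open import Data.Vec using ([]; _∷_; tabulate; here; there)
open import Data.Vec.Properties using (lookup∘tabulate; []=⇒lookup; lookup⇒[]=)
open import Data.Product using (_×_; _,_; Σ; ∃; ∃₂; proj₁; proj₂; ∃-syntax)
open import Data.Sum using (_⊎_; inj₁; inj₂; [_,_]′)
open import Function using (_∘_; mk⇔)
open import Relation.Binary.Definitions using (tri<; tri≈; tri>)
open import Relation.Binary.PropositionalEquality using (_≡_; _≢_; refl; sym; trans; cong; subst; subst₂)
open import Relation.Nullary using (¬_; Dec; does; yes; no; contradiction)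
open import Relation.Nullary.Decidable
  using (dec-true; dec-false; does-⇔; ¬?; _×-dec_; _⊎-dec_; decidable-stable)

private variable
  n : ℕ

x∈p⇒⁅x⁆⊆p : {p : Subset n} {x : Fin n} → x ∈ p → ⁅ x ⁆ ⊆ p
x∈p⇒⁅x⁆⊆p {p = p} {x} x∈p y∈⁅x⁆ = subst (_∈ p) (sym (x∈⁅y⁆⇒x≡y x y∈⁅x⁆)) x∈p

x∈p⇒1≤∣p∣ : {p : Subset n} {x : Fin n} → x ∈ p → 1 ≤ ∣ p ∣
x∈p⇒1≤∣p∣ {x = x} x∈p = subst (_≤ _) (∣⁅x⁆∣≡1 x) (p⊆q⇒∣p∣≤∣q∣ (x∈p⇒⁅x⁆⊆p x∈p))

2≤∣p∣ : {p : Subset n} {x y : Fin n} → x ∈ p → y ∈ p → x ≢ y → 2 ≤ ∣ p ∣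
2≤∣p∣ {x = x} {y} x∈p y∈p x≢y = subst (λ c → suc c ≤ _) (∣⁅x⁆∣≡1 x)
  (p⊂q⇒∣p∣<∣q∣ (x∈p⇒⁅x⁆⊆p x∈p , y , y∈p , λ y∈⁅x⁆ → x≢y (sym (x∈⁅y⁆⇒x≡y x y∈⁅x⁆))))

1≤∣p∣⇒Nonempty : (p : Subset n) → 1 ≤ ∣ p ∣ → Nonempty p
1≤∣p∣⇒Nonempty (true ∷ p)  _ = zero , here
1≤∣p∣⇒Nonempty (false ∷ p) h with 1≤∣p∣⇒Nonempty p h
... | x , x∈p = suc x , there x∈p

∣p∪q∣≤∣p∣+∣q∣ : (p q : Subset n) → ∣ p ∪ q ∣ ≤ ∣ p ∣ + ∣ q ∣
∣p∪q∣≤∣p∣+∣q∣ []          []          = z≤n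
∣p∪q∣≤∣p∣+∣q∣ (true ∷ p)  (true ∷ q)  =
  s≤s (≤-trans (m≤n⇒m≤1+n (∣p∪q∣≤∣p∣+∣q∣ p q)) (≤-reflexive (sym (+-suc ∣ p ∣ ∣ q ∣))))
∣p∪q∣≤∣p∣+∣q∣ (true ∷ p)  (false ∷ q) = s≤s (∣p∪q∣≤∣p∣+∣q∣ p q)
∣p∪q∣≤∣p∣+∣q∣ (false ∷ p) (true ∷ q)  =
  ≤-trans (s≤s (∣p∪q∣≤∣p∣+∣q∣ p q)) (≤-reflexive (sym (+-suc ∣ p ∣ ∣ q ∣)))
∣p∪q∣≤∣p∣+∣q∣ (false ∷ p) (false ∷ q) = ∣p∪q∣≤∣p∣+∣q∣ p q

p⊆q∪⁅y⁆⇒∣p∣≤1+∣q∣ : {p q : Subset n} (y : Fin n) → p ⊆ q ∪ ⁅ y ⁆ → ∣ p ∣ ≤ suc ∣ q ∣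
p⊆q∪⁅y⁆⇒∣p∣≤1+∣q∣ {q = q} y p⊆ = ≤-trans (p⊆q⇒∣p∣≤∣q∣ p⊆) (≤-trans (∣p∪q∣≤∣p∣+∣q∣ q ⁅ y ⁆)
  (≤-reflexive (trans (cong (∣ q ∣ +_) (∣⁅x⁆∣≡1 y)) (+-comm ∣ q ∣ 1))))

p⊆q∪⁅y⁆⇒∣p∣≤1+∣p∩q∣ : {p q : Subset n} (y : Fin n) → p ⊆ q ∪ ⁅ y ⁆ → ∣ p ∣ ≤ suc ∣ p ∩ q ∣
p⊆q∪⁅y⁆⇒∣p∣≤1+∣p∩q∣ {p = p} {q} y p⊆ = p⊆q∪⁅y⁆⇒∣p∣≤1+∣q∣ y sub
  where
  sub : p ⊆ (p ∩ q) ∪ ⁅ y ⁆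
  sub x∈p with x∈p∪q⁻ q ⁅ y ⁆ (p⊆ x∈p)
  ... | inj₁ x∈q = x∈p∪q⁺ (inj₁ (x∈p∩q⁺ (x∈p , x∈q)))
  ... | inj₂ x≡y = x∈p∪q⁺ (inj₂ x≡y)

p⊆q⇒∣p∩q∣≡∣p∣ : {p q : Subset n} → p ⊆ q → ∣ p ∩ q ∣ ≡ ∣ p ∣
p⊆q⇒∣p∩q∣≡∣p∣ {p = p} {q} p⊆q = ≤-antisym (∣p∩q∣≤∣p∣ p q) (p⊆q⇒∣p∣≤∣q∣ λ x∈p → x∈p∩q⁺ (x∈p , p⊆q x∈p))

2+∣p∣≤∣q∣ : {p q : Subset n} {x y : Fin n} → p ⊆ q → x ∈ q → x ∉ p → y ∈ q → y ∉ p → x ≢ y →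
            2 + ∣ p ∣ ≤ ∣ q ∣
2+∣p∣≤∣q∣ {p = p} {q} {x} {y} p⊆q x∈q x∉p y∈q y∉p x≢y =
  ≤-trans (s≤s (p⊂q⇒∣p∣<∣q∣ (p⊆q-y , x , x∈p∧x≢y⇒x∈p-y x∈q x≢y , x∉p))) (x∈p⇒∣p-x∣<∣p∣ y∈q)
  where
  p⊆q-y : p ⊆ q - y
  p⊆q-y {z} z∈p = x∈p∧x≢y⇒x∈p-y (p⊆q z∈p) λ { refl → y∉p z∈p }

p⊆q∪⁅a⁆⇒∣p∣<∣q∣ : {p q : Subset n} {x y : Fin n} (a : Fin n) → p ⊆ q ∪ ⁅ a ⁆ →
                   x ∈ q → x ∉ p → y ∈ q → y ∉ p → x ≢ y → ∣ p ∣ < ∣ q ∣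
p⊆q∪⁅a⁆⇒∣p∣<∣q∣ {p = p} {q} a p⊆ x∈q x∉p y∈q y∉p x≢y = ≤-trans (s≤s (p⊆q∪⁅y⁆⇒∣p∣≤1+∣p∩q∣ a p⊆))
  (2+∣p∣≤∣q∣ (p∩q⊆q p q) x∈q (x∉p ∘ proj₁ ∘ x∈p∩q⁻ p q) y∈q (y∉p ∘ proj₁ ∘ x∈p∩q⁻ p q) x≢y)

∉⇒≡⊎≡⇒n∸2≤∣p∣ : {p : Subset n} (x y : Fin n) → (∀ w → w ∉ p → w ≡ x ⊎ w ≡ y) → n ∸ 2 ≤ ∣ p ∣
∉⇒≡⊎≡⇒n∸2≤∣p∣ {n} {p} x y out = m≤n+o⇒m∸n≤o n 2 (subst (_≤ 2 + ∣ p ∣) (∣⊤∣≡n n)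
  (≤-trans (p⊆q∪⁅y⁆⇒∣p∣≤1+∣q∣ y ⊤⊆) (s≤s (p⊆q∪⁅y⁆⇒∣p∣≤1+∣q∣ {q = p} x (λ z → z)))))
  where
  ⊤⊆ : ⊤ ⊆ (p ∪ ⁅ x ⁆) ∪ ⁅ y ⁆
  ⊤⊆ {w} _ with w ∈? p
  ... | yes w∈p = x∈p∪q⁺ (inj₁ (x∈p∪q⁺ (inj₁ w∈p)))
  ... | no w∉p with out w w∉p
  ...   | inj₁ refl = x∈p∪q⁺ (inj₁ (x∈p∪q⁺ (inj₂ (x∈⁅x⁆ w))))
  ...   | inj₂ refl = x∈p∪q⁺ (inj₂ (x∈⁅x⁆ w))

∉-unique⇒n∸2≤∣p∣ : {p : Subset n} → (∀ {x y} → x ∉ p → y ∉ p → x ≡ y) → n ∸ 2 ≤ ∣ p ∣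
∉-unique⇒n∸2≤∣p∣ {n} {p} unique with nonempty? (∁ p)
... | yes (w , w∈∁p) = ∉⇒≡⊎≡⇒n∸2≤∣p∣ w w λ v v∉p → inj₁ (unique v∉p (x∈∁p⇒x∉p w∈∁p))
... | no ∁p-empty = ≤-trans (m∸n≤m n 2) (subst (_≤ ∣ p ∣) (∣⊤∣≡n n)
        (p⊆q⇒∣p∣≤∣q∣ {p = ⊤} λ {v} _ → decidable-stable (v ∈? p) λ v∉p → ∁p-empty (v , x∉p⇒x∈∁p v∉p)))

∁⁅_,_⁆ : Fin n → Fin n → Subset n
∁⁅ x , y ⁆ = ∁ (⁅ x ⁆ ∪ ⁅ y ⁆)

∣∁⁅x,y⁆∣≤n∸2 : {x y : Fin n} → x ≢ y → ∣ ∁⁅ x , y ⁆ ∣ ≤ n ∸ 2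
∣∁⁅x,y⁆∣≤n∸2 {n} {x} {y} x≢y = subst (_≤ n ∸ 2) (sym (∣∁p∣≡n∸∣p∣ (⁅ x ⁆ ∪ ⁅ y ⁆)))
  (∸-monoʳ-≤ n (2≤∣p∣ (p⊆p∪q ⁅ y ⁆ (x∈⁅x⁆ x)) (q⊆p∪q ⁅ x ⁆ ⁅ y ⁆ (x∈⁅x⁆ y)) x≢y))

∉∁⁅x,y⁆ : {x y w : Fin n} → w ∉ ∁⁅ x , y ⁆ → w ≡ x ⊎ w ≡ y
∉∁⁅x,y⁆ {x = x} {y} w∉ with x∈p∪q⁻ ⁅ x ⁆ ⁅ y ⁆ (x∉∁p⇒x∈p w∉)
... | inj₁ w∈⁅x⁆ = inj₁ (x∈⁅y⁆⇒x≡y x w∈⁅x⁆)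
... | inj₂ w∈⁅y⁆ = inj₂ (x∈⁅y⁆⇒x≡y y w∈⁅y⁆)

∈∁⁅x,y⁆ : {x y w : Fin n} → w ≢ x → w ≢ y → w ∈ ∁⁅ x , y ⁆
∈∁⁅x,y⁆ {x = x} {y} w≢x w≢y = x∉p⇒x∈∁p λ w∈ → [ w≢x ∘ x∈⁅y⁆⇒x≡y x , w≢y ∘ x∈⁅y⁆⇒x≡y y ]′ (x∈p∪q⁻ ⁅ x ⁆ ⁅ y ⁆ w∈)

y∉∁⁅x,y⁆ : {x y : Fin n} → y ∉ ∁⁅ x , y ⁆
y∉∁⁅x,y⁆ {x = x} {y} = x∈p⇒x∉∁p (x∈p∪q⁺ (inj₂ (x∈⁅x⁆ y)))

pigeonholeℕ : ∀ {m} → m < n → (f : Fin n → ℕ) → (∀ i → f i < m) → ∃₂ λ i j → i ≢ j × f i ≡ f j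
pigeonholeℕ m<n f f< with pigeonhole m<n (λ i → fromℕ< (f< i))
... | i , j , i<j , eq = i , j , <⇒≢ᶠ i<j ,
      trans (sym (toℕ-fromℕ< (f< i))) (trans (cong toℕ eq) (toℕ-fromℕ< (f< j)))

module _ (G : Graph n) where

  deg : Fin n → ℕ
  deg v = ∣ N G v ∣

  adj⇒∈N : ∀ {v w} → adj G v w ≡ true → w ∈ N G v
  adj⇒∈N {v} {w} v~w = lookup⇒[]= w (N G v) (trans (lookup∘tabulate (adj G v) w) v~w)

  ∈N⇒adj : ∀ {v w} → w ∈ N G v → adj G v w ≡ true
  ∈N⇒adj {v} {w} w∈ = trans (sym (lookup∘tabulate (adj G v) w)) ([]=⇒lookup w∈)

  ¬adj⇒∉N : ∀ {v w} → adj G v w ≡ false → w ∉ N G v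
  ¬adj⇒∉N v≁w w∈ with trans (sym (∈N⇒adj w∈)) v≁w
  ... | ()

  v∉N[v] : ∀ v → v ∉ N G v
  v∉N[v] v = ¬adj⇒∉N (irefl G v)

  1≤deg : MinDeg≥1 G → ∀ v → 1 ≤ deg v
  1≤deg δ v = x∈p⇒1≤∣p∣ (adj⇒∈N (proj₂ (δ v)))

  deg<n : ∀ v → deg v < n
  deg<n v = subst (deg v <_) (∣⊤∣≡n n) (p⊂q⇒∣p∣<∣q∣ ((λ _ → ∈⊤) , v , ∈⊤ , v∉N[v] v))

  non-neighbour⇒2+deg≤n : ∀ {u v} → adj G v u ≡ false → u ≢ v → 2 + deg v ≤ n
  non-neighbour⇒2+deg≤n {u} {v} v≁u u≢v =
    subst (2 + deg v ≤_) (∣⊤∣≡n n) (2+∣p∣≤∣q∣ (λ _ → ∈⊤) ∈⊤ (¬adj⇒∉N v≁u) ∈⊤ (v∉N[v] v) u≢v)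

  unique-neighbour : ∀ {u v w} → deg v ≡ 1 → adj G v u ≡ true → adj G v w ≡ true → w ≡ u
  unique-neighbour {u} {v} {w} dv≡1 v~u v~w with w ≟ᶠ u
  ... | yes w≡u = w≡u
  ... | no w≢u = contradiction (2≤∣p∣ (adj⇒∈N v~w) (adj⇒∈N v~u) w≢u) (<⇒≱ (≤-reflexive (cong suc dv≡1)))

  fair⇒dominating : ∀ {k D} → 1 ≤ k → (∀ v → v ∉ D → ∣ N G v ∩ D ∣ ≡ k) → Dominating G D
  fair⇒dominating {k} {D} 1≤k fair v v∉D with 1≤∣p∣⇒Nonempty (N G v ∩ D) (subst (1 ≤_) (sym (fair v v∉D)) 1≤k)
  ... | u , u∈ with x∈p∩q⁻ (N G v) D u∈
  ... | u∈N , u∈D = u , u∈D , ∈N⇒adj u∈N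

  N⊆∁⁅x,y⁆∪⁅y⁆ : ∀ {x} y → N G x ⊆ ∁⁅ x , y ⁆ ∪ ⁅ y ⁆
  N⊆∁⁅x,y⁆∪⁅y⁆ {x} y {w} w∈N with w ≟ᶠ y
  ... | yes refl = x∈p∪q⁺ (inj₂ (x∈⁅x⁆ w))
  ... | no w≢y = x∈p∪q⁺ (inj₁ (∈∁⁅x,y⁆ (λ { refl → v∉N[v] x w∈N }) w≢y))

  ∣N∩∁⁅x,y⁆∣≡deg : ∀ {x y} → adj G x y ≡ false → ∣ N G x ∩ ∁⁅ x , y ⁆ ∣ ≡ deg x
  ∣N∩∁⁅x,y⁆∣≡deg {x} {y} x≁y = p⊆q⇒∣p∩q∣≡∣p∣ N⊆
    where
    N⊆ : N G x ⊆ ∁⁅ x , y ⁆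
    N⊆ w∈N with x∈p∪q⁻ _ ⁅ y ⁆ (N⊆∁⁅x,y⁆∪⁅y⁆ y w∈N)
    ... | inj₁ w∈∁ = w∈∁
    ... | inj₂ w∈⁅y⁆ = contradiction (subst (_∈ N G x) (x∈⁅y⁆⇒x≡y y w∈⁅y⁆) w∈N) (¬adj⇒∉N x≁y)

  1+∣N∩∁⁅x,y⁆∣≡deg : ∀ {x y} → adj G x y ≡ true → suc ∣ N G x ∩ ∁⁅ x , y ⁆ ∣ ≡ deg x
  1+∣N∩∁⁅x,y⁆∣≡deg {x} {y} x~y = ≤-antisym
    (p⊂q⇒∣p∣<∣q∣ (p∩q⊆p _ _ , y , adj⇒∈N x~y , y∉∁⁅x,y⁆ ∘ proj₂ ∘ x∈p∩q⁻ _ _))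
    (p⊆q∪⁅y⁆⇒∣p∣≤1+∣p∩q∣ y (N⊆∁⁅x,y⁆∪⁅y⁆ y))

  fdLe-∁⁅x,y⁆ : ∀ {x y k} → x ≢ y → 1 ≤ k → ∣ N G x ∩ ∁⁅ x , y ⁆ ∣ ≡ k → ∣ N G y ∩ ∁⁅ y , x ⁆ ∣ ≡ k →
                FdLe G (n ∸ 2)
  fdLe-∁⁅x,y⁆ {x} {y} {k} x≢y 1≤k cx cy =
    ∁⁅ x , y ⁆ , (k , 1≤k , fair⇒dominating 1≤k fair , fair) , ∣∁⁅x,y⁆∣≤n∸2 x≢y
    where
    fair : ∀ v → v ∉ ∁⁅ x , y ⁆ → ∣ N G v ∩ ∁⁅ x , y ⁆ ∣ ≡ k
    fair v v∉ with ∉∁⁅x,y⁆ v∉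
    ... | inj₁ refl = cx
    ... | inj₂ refl rewrite ∪-comm ⁅ x ⁆ ⁅ v ⁆ = cy

  equal-degrees⇒fdLe : MinDeg≥1 G → ∀ {x y} → x ≢ y → deg x ≡ deg y → (adj G x y ≡ true → 2 ≤ deg x) →
                       FdLe G (n ∸ 2)
  equal-degrees⇒fdLe δ {x} {y} x≢y dx≡dy 2≤dx with adj G x y in x~y
  ... | false = fdLe-∁⁅x,y⁆ x≢y (1≤deg δ x) (∣N∩∁⁅x,y⁆∣≡deg x~y)
                  (trans (∣N∩∁⁅x,y⁆∣≡deg (trans (Graph.sym G y x) x~y)) (sym dx≡dy))
  ... | true = fdLe-∁⁅x,y⁆ x≢y (≤-pred (subst (2 ≤_) (sym cx) (2≤dx refl))) refl
                  (suc-injective (trans cy (trans (sym dx≡dy) (sym cx))))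
    where
    cx : suc ∣ N G x ∩ ∁⁅ x , y ⁆ ∣ ≡ deg x
    cx = 1+∣N∩∁⁅x,y⁆∣≡deg x~y
    cy : suc ∣ N G y ∩ ∁⁅ y , x ⁆ ∣ ≡ deg y
    cy = 1+∣N∩∁⁅x,y⁆∣≡deg (trans (Graph.sym G y x) x~y)

  IsolatedEdge : Fin n → Fin n → Set
  IsolatedEdge x y = adj G x y ≡ true × deg x ≡ 1 × deg y ≡ 1

  equal-degrees⇒fdLe⊎isolated : MinDeg≥1 G → ∀ {x y} → x ≢ y → deg x ≡ deg y →
                                FdLe G (n ∸ 2) ⊎ IsolatedEdge x y
  equal-degrees⇒fdLe⊎isolated δ {x} {y} x≢y dx≡dy with adj G x y in x~y | deg x ≟ 1
  ... | true | yes dx≡1 = inj₂ (refl , dx≡1 , trans (sym dx≡dy) dx≡1)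
  ... | true | no dx≢1 = inj₁ (equal-degrees⇒fdLe δ x≢y dx≡dy λ _ → ≤∧≢⇒< (1≤deg δ x) (dx≢1 ∘ sym))
  ... | false | _ = inj₁ (equal-degrees⇒fdLe δ x≢y dx≡dy λ x~y′ → contradiction (trans (sym x~y) x~y′) λ ())

  degree-twins : 1 ≤ n → MinDeg≥1 G → ∃₂ λ x y → x ≢ y × deg x ≡ deg y
  degree-twins 1≤n δ
    with pigeonholeℕ (∸-monoˡ-< (n<1+n _) 1≤n) (λ v → deg v ∸ 1) (λ v → ∸-monoˡ-< (deg<n v) (1≤deg δ v))
  ... | x , y , x≢y , eq = x , y , x≢y , ∸-cancelʳ-≡ (1≤deg δ x) (1≤deg δ y) eq

  degree-twins-avoiding : 3 ≤ n → MinDeg≥1 G → ∀ {x y} → IsolatedEdge x y →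
                          ∃₂ λ i j → i ≢ j × i ≢ x × j ≢ x × deg i ≡ deg j
  degree-twins-avoiding 3≤n δ {x} {y} (x~y , dx≡1 , dy≡1) =
    twins (pigeonholeℕ (∸-monoˡ-< (n<1+n n) (≤-trans (s≤s z≤n) 3≤n)) g g<n∸1)
    where
    -- x is the only vertex with g = 0; every other vertex has degree in 1 … n − 2.
    g : Fin n → ℕ
    g v with v ≟ᶠ x
    ... | yes _ = 0
    ... | no _ = deg v

    g-spec : ∀ v → (v ≡ x × g v ≡ 0) ⊎ (v ≢ x × g v ≡ deg v)
    g-spec v with v ≟ᶠ x
    ... | yes v≡x = inj₁ (v≡x , refl)
    ... | no v≢x = inj₂ (v≢x , refl)

    2+deg≤n : ∀ {v} → v ≢ x → 2 + deg v ≤ n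
    2+deg≤n {v} v≢x with v ≟ᶠ y | adj G v x in v~x
    ... | yes refl | _ = subst (λ d → 2 + d ≤ n) (sym dy≡1) 3≤n
    ... | no v≢y | false = non-neighbour⇒2+deg≤n v~x (v≢x ∘ sym)
    ... | no v≢y | true = contradiction (unique-neighbour dx≡1 x~y (trans (Graph.sym G x v) v~x)) v≢y

    g<n∸1 : ∀ v → g v < n ∸ 1
    g<n∸1 v with g-spec v
    ... | inj₁ (_ , gv≡0) = subst (_< n ∸ 1) (sym gv≡0) (∸-monoˡ-≤ 1 (≤-trans (s≤s (s≤s z≤n)) 3≤n))
    ... | inj₂ (v≢x , gv≡dv) = subst (_< n ∸ 1) (sym gv≡dv) (∸-monoˡ-≤ 1 (2+deg≤n v≢x))

    twins : (∃₂ λ i j → i ≢ j × g i ≡ g j) → ∃₂ λ i j → i ≢ j × i ≢ x × j ≢ x × deg i ≡ deg j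
    twins (i , j , i≢j , gi≡gj) with g-spec i | g-spec j
    ... | inj₁ (refl , _)    | inj₁ (refl , _)    = contradiction refl i≢j
    ... | inj₁ (_ , gi≡0)    | inj₂ (_ , gj≡dj)   =
      contradiction (trans (sym gi≡0) (trans gi≡gj gj≡dj)) (<⇒≢ (1≤deg δ j))
    ... | inj₂ (_ , gi≡di)   | inj₁ (_ , gj≡0)    =
      contradiction (trans (sym gj≡0) (trans (sym gi≡gj) gi≡di)) (<⇒≢ (1≤deg δ i))
    ... | inj₂ (i≢x , gi≡di) | inj₂ (j≢x , gj≡dj) = i , j , i≢j , i≢x , j≢x , trans (sym gi≡di) (trans gi≡gj gj≡dj)

  isolatedEdge⇒fdLe : 3 ≤ n → MinDeg≥1 G → ∀ {x y} → IsolatedEdge x y → FdLe G (n ∸ 2)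
  isolatedEdge⇒fdLe 3≤n δ {x} {y} iso@(x~y , dx≡1 , dy≡1) with degree-twins-avoiding 3≤n δ iso
  ... | i , j , i≢j , i≢x , j≢x , di≡dj with equal-degrees⇒fdLe⊎isolated δ i≢j di≡dj
  ... | inj₁ fd = fd
  ... | inj₂ (i~j , di≡1 , _) =
    equal-degrees⇒fdLe δ (i≢x ∘ sym) (trans dx≡1 (sym di≡1))
      λ x~i → contradiction (unique-neighbour dx≡1 x~y x~i) i≢y
    where
    i≢y : i ≢ y
    i≢y refl = j≢x (unique-neighbour dy≡1 (trans (Graph.sym G y x) x~y) i~j)

  minDeg≥1⇒fdLe : 3 ≤ n → MinDeg≥1 G → FdLe G (n ∸ 2)
  minDeg≥1⇒fdLe 3≤n δ with degree-twins (≤-trans (s≤s z≤n) 3≤n) δ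
  ... | x , y , x≢y , dx≡dy with equal-degrees⇒fdLe⊎isolated δ x≢y dx≡dy
  ... | inj₁ fd = fd
  ... | inj₂ iso = isolatedEdge⇒fdLe 3≤n δ iso

  module _ {k : ℕ} {D : Subset n} (fair : ∀ v → v ∉ D → ∣ N G v ∩ D ∣ ≡ k) where

    fair-strictly-nested⇒⊥ : ∀ {x y z} → x ∉ D → y ∉ D →
                             (∀ {w} → w ∈ D → adj G x w ≡ true → adj G y w ≡ true) →
                             z ∈ D → adj G y z ≡ true → adj G x z ≡ false → ⊥
    fair-strictly-nested⇒⊥ {x} {y} {z} x∉D y∉D nested z∈D y~z x≁z =
      <-irrefl (trans (fair x x∉D) (sym (fair y y∉D)))
        (p⊂q⇒∣p∣<∣q∣ (N∩D⊆ , z , x∈p∩q⁺ (adj⇒∈N y~z , z∈D) , ¬adj⇒∉N x≁z ∘ proj₁ ∘ x∈p∩q⁻ _ _))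
      where
      N∩D⊆ : N G x ∩ D ⊆ N G y ∩ D
      N∩D⊆ w∈ with x∈p∩q⁻ (N G x) D w∈
      ... | w∈N , w∈D = x∈p∩q⁺ (adj⇒∈N (nested w∈D (∈N⇒adj w∈N)) , w∈D)

    fair-two-neighbours⇒2≤k : ∀ {x u w} → x ∉ D → u ∈ D → w ∈ D → u ≢ w →
                              adj G x u ≡ true → adj G x w ≡ true → 2 ≤ k
    fair-two-neighbours⇒2≤k {x} x∉D u∈D w∈D u≢w x~u x~w =
      subst (2 ≤_) (fair x x∉D) (2≤∣p∣ (x∈p∩q⁺ (adj⇒∈N x~u , u∈D)) (x∈p∩q⁺ (adj⇒∈N x~w , w∈D)) u≢w)

fdLe+lowerBound⇒fdEq : ∀ {b} (G : Graph n) → FdLe G b → (∀ D → FairDom G D → b ≤ ∣ D ∣) → FdEq G b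
fdLe+lowerBound⇒fdEq G (D , fairD , ∣D∣≤b) lower = (D , fairD , ≤-antisym ∣D∣≤b (lower D fairD)) , lower

module Extremal (s : ℕ) where

  -- r ≥ 3 makes the labels r − 1 and r − 2 used in 3+r≤⇒∉⇒⊥ positive.
  r : ℕ
  r = 3 + s

  order : ℕ
  order = suc (r + r)

  Adj : ℕ → ℕ → Set
  Adj a b = (a ≡ 0 × b ≡ r) ⊎ (a ≡ r × b ≡ 0) ⊎ (a ≢ b × order ≤ a + b)

  Adj? : ∀ a b → Dec (Adj a b)
  Adj? a b = (a ≟ 0 ×-dec b ≟ r) ⊎-dec (a ≟ r ×-dec b ≟ 0) ⊎-dec (¬? (a ≟ b) ×-dec order ≤? a + b)

  Adj-sym : ∀ {a b} → Adj a b → Adj b a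
  Adj-sym (inj₁ (a≡0 , b≡r))              = inj₂ (inj₁ (b≡r , a≡0))
  Adj-sym (inj₂ (inj₁ (a≡r , b≡0)))       = inj₁ (b≡0 , a≡r)
  Adj-sym {a} {b} (inj₂ (inj₂ (a≢b , n≤))) = inj₂ (inj₂ (a≢b ∘ sym , subst (order ≤_) (+-comm a b) n≤))

  Adj-irrefl : ∀ {a} → ¬ Adj a a
  Adj-irrefl (inj₁ (refl , ()))
  Adj-irrefl (inj₂ (inj₁ (refl , ())))
  Adj-irrefl (inj₂ (inj₂ (a≢a , _))) = a≢a refl

  -- Abstract, so that adj G u v stays folded instead of unfolding to a Boolean decision procedure.
  abstract
    G : Graph order
    G = record
      { adj   = λ u v → does (Adj? (toℕ u) (toℕ v))
      ; sym   = λ u v → does-⇔ (mk⇔ Adj-sym Adj-sym) (Adj? (toℕ u) (toℕ v)) (Adj? (toℕ v) (toℕ u))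
      ; irefl = λ v → dec-false (Adj? (toℕ v) (toℕ v)) Adj-irrefl
      }

    Adj⇒adj : ∀ {u v} → Adj (toℕ u) (toℕ v) → adj G u v ≡ true
    Adj⇒adj {u} {v} = dec-true (Adj? (toℕ u) (toℕ v))

    ¬Adj⇒¬adj : ∀ {u v} → ¬ Adj (toℕ u) (toℕ v) → adj G u v ≡ false
    ¬Adj⇒¬adj {u} {v} = dec-false (Adj? (toℕ u) (toℕ v))

    adj⇒Adj : ∀ {u v} → adj G u v ≡ true → Adj (toℕ u) (toℕ v)
    adj⇒Adj {u} {v} = does≡true⇒ (Adj? (toℕ u) (toℕ v))
      where
      does≡true⇒ : ∀ {A : Set} (a? : Dec A) → does a? ≡ true → A
      does≡true⇒ (yes a) _ = a

  far⇒adj : ∀ {u v} → toℕ u ≢ toℕ v → order ≤ toℕ u + toℕ v → adj G u v ≡ true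
  far⇒adj u≢v n≤ = Adj⇒adj (inj₂ (inj₂ (u≢v , n≤)))

  vertex : (a : ℕ) → a ≤ r + r → Fin order
  vertex a a≤ = fromℕ< (s≤s a≤)

  toℕ-vertex : ∀ a (a≤ : a ≤ r + r) → toℕ (vertex a a≤) ≡ a
  toℕ-vertex a a≤ = toℕ-fromℕ< (s≤s a≤)

  v₀ vᵣ v₁ v₂ᵣ : Fin order
  v₀  = vertex 0 z≤n
  vᵣ  = vertex r (m≤m+n r r)
  v₁  = vertex 1 (s≤s z≤n)
  v₂ᵣ = vertex (r + r) ≤-refl

  toℕ-vᵣ : toℕ vᵣ ≡ r
  toℕ-vᵣ = toℕ-vertex r (m≤m+n r r)

  toℕ-v₂ᵣ : toℕ v₂ᵣ ≡ r + r
  toℕ-v₂ᵣ = toℕ-vertex (r + r) ≤-refl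

  toℕ≤r+r : ∀ v → toℕ v ≤ r + r
  toℕ≤r+r v = toℕ≤pred[n] {n = order} v

  order≰toℕ : ∀ v → ¬ (order ≤ toℕ v)
  order≰toℕ v = ≤⇒≯ (toℕ≤r+r v)

  vᵣ~v₀ : adj G vᵣ v₀ ≡ true
  vᵣ~v₀ = Adj⇒adj (inj₂ (inj₁ (toℕ-vᵣ , refl)))

  ≢r⇒¬adj-v₀ : ∀ {x} → toℕ x ≢ r → adj G x v₀ ≡ false
  ≢r⇒¬adj-v₀ x≢r = ¬Adj⇒¬adj λ
    { (inj₁ (_ , 0≡r))            → contradiction 0≡r λ ()
    ; (inj₂ (inj₁ (x≡r , _)))      → x≢r x≡r
    ; (inj₂ (inj₂ (_ , n≤x+0)))    → order≰toℕ _ (subst (order ≤_) (+-identityʳ _) n≤x+0) }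

  near⇒¬adj : ∀ {x z} → toℕ x ≢ 0 → toℕ x ≢ r → toℕ x + toℕ z < order → adj G x z ≡ false
  near⇒¬adj x≢0 x≢r x+z<n = ¬Adj⇒¬adj λ
    { (inj₁ (x≡0 , _))          → x≢0 x≡0
    ; (inj₂ (inj₁ (x≡r , _)))   → x≢r x≡r
    ; (inj₂ (inj₂ (_ , n≤x+z))) → <⇒≱ x+z<n n≤x+z }

  <r⇒¬adj-vᵣ : ∀ {x} → toℕ x ≢ 0 → toℕ x < r → adj G x vᵣ ≡ false
  <r⇒¬adj-vᵣ {x} x≢0 x<r = near⇒¬adj x≢0 (<⇒≢ x<r)
    (subst (λ c → toℕ x + c < order) (sym toℕ-vᵣ) (s≤s (+-monoˡ-≤ r (<⇒≤ x<r))))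

  r<⇒adj-vᵣ : ∀ {u} → r < toℕ u → adj G u vᵣ ≡ true
  r<⇒adj-vᵣ {u} r<u = far⇒adj (λ u≡ → <⇒≢ r<u (sym (trans u≡ toℕ-vᵣ)))
    (subst (λ c → order ≤ toℕ u + c) (sym toℕ-vᵣ) (+-monoˡ-≤ r r<u))

  ≢0⇒adj-v₂ᵣ : ∀ {u} → toℕ u ≢ 0 → toℕ u ≢ r + r → adj G u v₂ᵣ ≡ true
  ≢0⇒adj-v₂ᵣ {u} u≢0 u≢2r = far⇒adj (λ u≡ → u≢2r (trans u≡ toℕ-v₂ᵣ))
    (subst (λ c → order ≤ toℕ u + c) (sym toℕ-v₂ᵣ) (+-monoˡ-≤ (r + r) (n≢0⇒n>0 u≢0)))

  v₀-adj⇒≡vᵣ : ∀ {u} → adj G v₀ u ≡ true → u ≡ vᵣ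
  v₀-adj⇒≡vᵣ {u} v₀~u with adj⇒Adj {v₀} {u} v₀~u
  ... | inj₁ (_ , u≡r)          = toℕ-injective (trans u≡r (sym toℕ-vᵣ))
  ... | inj₂ (inj₁ (0≡r , _))   = contradiction 0≡r λ ()
  ... | inj₂ (inj₂ (_ , n≤0+u)) = contradiction n≤0+u (order≰toℕ u)

  v₁-adj⇒≡v₂ᵣ : ∀ {u} → adj G v₁ u ≡ true → u ≡ v₂ᵣ
  v₁-adj⇒≡v₂ᵣ {u} v₁~u with adj⇒Adj {v₁} {u} v₁~u
  ... | inj₁ (() , _)
  ... | inj₂ (inj₁ (1≡r , _))   = contradiction 1≡r λ ()
  ... | inj₂ (inj₂ (_ , n≤1+u)) = toℕ-injective (trans (≤-antisym (toℕ≤r+r u) (≤-pred n≤1+u)) (sym toℕ-v₂ᵣ))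

  partner : ∀ v → toℕ v ≢ 0 → ∃ λ w → toℕ w + toℕ v ≡ order
  partner v v≢0 = vertex (order ∸ toℕ v) bound ,
    trans (cong (_+ toℕ v) (toℕ-vertex _ bound)) (m∸n+n≡m (<⇒≤ (toℕ<n v)))
    where
    bound : order ∸ toℕ v ≤ r + r
    bound = ∸-monoʳ-≤ order (n≢0⇒n>0 v≢0)

  ≤r⇒r<partner : ∀ {a b} → a + b ≡ order → a ≤ r → r < b
  ≤r⇒r<partner a+b≡n a≤r = ≰⇒> λ b≤r → n≮n (r + r) (subst (_≤ r + r) a+b≡n (+-mono-≤ a≤r b≤r))

  r<⇒partner≤r : ∀ {a b} → a + b ≡ order → r < a → b ≤ r
  r<⇒partner≤r a+b≡n r<a = ≮⇒≥ λ r<b → n≮n order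
    (subst₂ _≤_ (cong suc (+-suc r r)) a+b≡n (+-mono-≤ r<a r<b))

  2r+b≡order⇒b≡1 : ∀ {b} → (r + r) + b ≡ order → b ≡ 1
  2r+b≡order⇒b≡1 {b} eq = +-cancelˡ-≡ (r + r) b 1 (trans eq (+-comm 1 (r + r)))

  module LowerBound {k : ℕ} {D : Subset order}
                    (dom : Dominating G D) (fair : ∀ v → v ∉ D → ∣ N G v ∩ D ∣ ≡ k) where

    ∉∈⇒toℕ≢ : ∀ {x w} → x ∉ D → w ∈ D → toℕ x ≢ toℕ w
    ∉∈⇒toℕ≢ x∉D w∈D x≡w = x∉D (subst (_∈ D) (toℕ-injective (sym x≡w)) w∈D)

    -- Away from the labels 0 and r adjacency is the threshold rule, so to nest N(x) ∩ D into
    -- N(y) it suffices that y sees every D-vertex far from x.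
    far-nesting⇒⊥ : ∀ {x y z} → x ∉ D → y ∉ D → toℕ x ≢ 0 → toℕ x ≢ r →
                    (∀ {w} → w ∈ D → order ≤ toℕ x + toℕ w → adj G y w ≡ true) →
                    z ∈ D → adj G y z ≡ true → adj G x z ≡ false → ⊥
    far-nesting⇒⊥ {x} {y} x∉D y∉D x≢0 x≢r far = fair-strictly-nested⇒⊥ G fair x∉D y∉D nested
      where
      nested : ∀ {w} → w ∈ D → adj G x w ≡ true → adj G y w ≡ true
      nested {w} w∈D x~w with adj⇒Adj {x} {w} x~w
      ... | inj₁ (x≡0 , _)          = contradiction x≡0 x≢0
      ... | inj₂ (inj₁ (x≡r , _))   = contradiction x≡r x≢r
      ... | inj₂ (inj₂ (_ , n≤x+w)) = far w∈D n≤x+w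

    module Case-v₀∈D∧vᵣ∈D (v₀∈D : v₀ ∈ D) (vᵣ∈D : vᵣ ∈ D) where

      ∉⇒≢0 : ∀ {x} → x ∉ D → toℕ x ≢ 0
      ∉⇒≢0 x∉D = ∉∈⇒toℕ≢ x∉D v₀∈D

      ∉⇒≢r : ∀ {x} → x ∉ D → toℕ x ≢ r
      ∉⇒≢r x∉D x≡r = ∉∈⇒toℕ≢ x∉D vᵣ∈D (trans x≡r (sym toℕ-vᵣ))

      upward-nesting⇒⊥ : ∀ {x y z} → x ∉ D → y ∉ D → toℕ x ≤ toℕ y →
                         z ∈ D → adj G y z ≡ true → adj G x z ≡ false → ⊥
      upward-nesting⇒⊥ {x} {y} x∉D y∉D x≤y = far-nesting⇒⊥ x∉D y∉D (∉⇒≢0 x∉D) (∉⇒≢r x∉D)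
        λ w∈D n≤x+w → far⇒adj (∉∈⇒toℕ≢ y∉D w∈D) (≤-trans n≤x+w (+-monoˡ-≤ _ x≤y))

      across-r⇒⊥ : ∀ {x y} → x ∉ D → y ∉ D → toℕ x < r → r < toℕ y → ⊥
      across-r⇒⊥ x∉D y∉D x<r r<y = upward-nesting⇒⊥ x∉D y∉D (<⇒≤ (<-trans x<r r<y)) vᵣ∈D
        (r<⇒adj-vᵣ r<y) (<r⇒¬adj-vᵣ (∉⇒≢0 x∉D) x<r)

      ordered⇒⊥ : ∀ {x y} → x ∉ D → y ∉ D → toℕ x < toℕ y → ⊥
      -- The partner z of y sees y but not x; if z ∉ D instead, then z and y lie on opposite sides of r.
      ordered⇒⊥ {x} {y} x∉D y∉D x<y with partner y (∉⇒≢0 y∉D)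
      ... | z , z+y≡n with z ∈? D
      ... | yes z∈D = upward-nesting⇒⊥ x∉D y∉D (<⇒≤ x<y) z∈D
              (far⇒adj (∉∈⇒toℕ≢ y∉D z∈D) (≤-reflexive (trans (sym z+y≡n) (+-comm (toℕ z) (toℕ y)))))
              (near⇒¬adj (∉⇒≢0 x∉D) (∉⇒≢r x∉D) x+z<n)
        where
        x+z<n : toℕ x + toℕ z < order
        x+z<n = subst (toℕ x + toℕ z <_) (trans (+-comm (toℕ y) (toℕ z)) z+y≡n) (+-monoˡ-< (toℕ z) x<y)
      ... | no z∉D with <-cmp (toℕ z) r
      ...   | tri< z<r _ _ = across-r⇒⊥ z∉D y∉D z<r (≤r⇒r<partner z+y≡n (<⇒≤ z<r))
      ...   | tri≈ _ z≡r _ = ∉⇒≢r z∉D z≡r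
      ...   | tri> _ _ r<z = across-r⇒⊥ x∉D z∉D (<-≤-trans x<y (r<⇒partner≤r z+y≡n r<z)) r<z

      ∉-unique : ∀ {x y} → x ∉ D → y ∉ D → x ≡ y
      ∉-unique {x} {y} x∉D y∉D with <-cmp (toℕ x) (toℕ y)
      ... | tri< x<y _ _ = ⊥-elim (ordered⇒⊥ x∉D y∉D x<y)
      ... | tri≈ _ x≡y _ = toℕ-injective x≡y
      ... | tri> _ _ y<x = ⊥-elim (ordered⇒⊥ y∉D x∉D y<x)

    module Case-v₀∈D∧vᵣ∉D (v₀∈D : v₀ ∈ D) (vᵣ∉D : vᵣ ∉ D) where

      ∉⇒≢0 : ∀ {x} → x ∉ D → toℕ x ≢ 0
      ∉⇒≢0 x∉D = ∉∈⇒toℕ≢ x∉D v₀∈D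

      ∈⇒≢r : ∀ {u} → u ∈ D → toℕ u ≢ r
      ∈⇒≢r u∈D u≡r = ∉∈⇒toℕ≢ vᵣ∉D u∈D (trans toℕ-vᵣ (sym u≡r))

      vᵣ-nesting⇒⊥ : ∀ {w} → w ∉ D → toℕ w ≢ r → (∀ {u} → u ∈ D → order ≤ toℕ w + toℕ u → r < toℕ u) → ⊥
      vᵣ-nesting⇒⊥ {w} w∉D w≢r far = far-nesting⇒⊥ w∉D vᵣ∉D (∉⇒≢0 w∉D) w≢r
        (λ {u} u∈D n≤w+u → trans (Graph.sym G vᵣ u) (r<⇒adj-vᵣ (far u∈D n≤w+u))) v₀∈D vᵣ~v₀ (≢r⇒¬adj-v₀ w≢r)

      <r⇒∈ : ∀ {w} → toℕ w ≢ 0 → toℕ w < r → w ∈ D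
      <r⇒∈ {w} w≢0 w<r = decidable-stable (w ∈? D) λ w∉D → vᵣ-nesting⇒⊥ w∉D (<⇒≢ w<r)
        λ {u} _ n≤w+u → ≰⇒> λ u≤r → n≮n order (≤-trans (s≤s n≤w+u) (≤-trans (+-mono-≤ w<r u≤r) (n≤1+n (r + r))))

      ≡1+r⇒∉⇒⊥ : ∀ {w} → w ∉ D → toℕ w ≡ suc r → ⊥
      ≡1+r⇒∉⇒⊥ {w} w∉D w≡1+r = vᵣ-nesting⇒⊥ w∉D (λ w≡r → <⇒≢ (n<1+n r) (trans (sym w≡r) w≡1+r))
        λ {u} u∈D n≤w+u → ≤∧≢⇒< (+-cancelˡ-≤ r r (toℕ u) (≤-pred (subst (λ c → order ≤ c + toℕ u) w≡1+r n≤w+u)))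
                                 (∈⇒≢r u∈D ∘ sym)

      -- N(vᵣ) ∩ D ⊆ (N(w) ∩ D) ∪ {v₀}, while the vertices r − 1 and r − 2 lie in N(w) ∩ D but not
      -- in N(vᵣ); so N(vᵣ) and N(w) cannot both meet D in k vertices.
      3+r≤⇒∉⇒⊥ : ∀ {w} → w ∉ D → 3 + r ≤ toℕ w → ⊥
      3+r≤⇒∉⇒⊥ {w} w∉D 3+r≤w = <-irrefl (trans (fair vᵣ vᵣ∉D) (sym (fair w w∉D)))
        (p⊆q∪⁅a⁆⇒∣p∣<∣q∣ v₀ N[vᵣ]∩D⊆
          (proj₁ b₁-witness) (proj₂ b₁-witness) (proj₁ b₂-witness) (proj₂ b₂-witness) b₁≢b₂)
        where
        2+s≤r+r : 2 + s ≤ r + r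
        2+s≤r+r = ≤-trans (n≤1+n _) (m≤m+n r r)

        b₁ b₂ : Fin order
        b₁ = vertex (2 + s) 2+s≤r+r
        b₂ = vertex (1 + s) (≤-trans (n≤1+n _) 2+s≤r+r)

        b₁-label : toℕ b₁ ≡ 2 + s
        b₁-label = toℕ-vertex (2 + s) 2+s≤r+r

        b₂-label : toℕ b₂ ≡ 1 + s
        b₂-label = toℕ-vertex (1 + s) (≤-trans (n≤1+n _) 2+s≤r+r)

        b₁≢b₂ : b₁ ≢ b₂
        b₁≢b₂ b₁≡b₂ = <⇒≢ (n<1+n (1 + s)) (trans (sym b₂-label) (trans (cong toℕ (sym b₁≡b₂)) b₁-label))

        order≡3+r+1+s : order ≡ (3 + r) + (1 + s)
        order≡3+r+1+s = cong suc (trans (+-suc r (2 + s)) (cong suc (+-suc r (1 + s))))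

        witness : ∀ {b a} → toℕ b ≡ a → 1 + s ≤ a → a < r → b ∈ N G w ∩ D × b ∉ N G vᵣ ∩ D
        witness {b} {a} b≡a 1+s≤a a<r = x∈p∩q⁺ (adj⇒∈N G w~b , b∈D) , b∉N[vᵣ] ∘ proj₁ ∘ x∈p∩q⁻ (N G vᵣ) D
          where
          b≢0 : toℕ b ≢ 0
          b≢0 b≡0 = contradiction (subst (1 + s ≤_) (trans (sym b≡a) b≡0) 1+s≤a) λ ()
          b<r : toℕ b < r
          b<r = subst (_< r) (sym b≡a) a<r
          b∈D : b ∈ D
          b∈D = <r⇒∈ b≢0 b<r
          w~b : adj G w b ≡ true
          w~b = far⇒adj (∉∈⇒toℕ≢ w∉D b∈D)
            (subst (_≤ toℕ w + toℕ b) (sym order≡3+r+1+s) (+-mono-≤ 3+r≤w (subst (1 + s ≤_) (sym b≡a) 1+s≤a)))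
          b∉N[vᵣ] : b ∉ N G vᵣ
          b∉N[vᵣ] = ¬adj⇒∉N G (trans (Graph.sym G vᵣ b) (<r⇒¬adj-vᵣ b≢0 b<r))

        b₁-witness : b₁ ∈ N G w ∩ D × b₁ ∉ N G vᵣ ∩ D
        b₁-witness = witness b₁-label (n≤1+n _) ≤-refl

        b₂-witness : b₂ ∈ N G w ∩ D × b₂ ∉ N G vᵣ ∩ D
        b₂-witness = witness b₂-label ≤-refl (n≤1+n _)

        N[vᵣ]∩D⊆ : N G vᵣ ∩ D ⊆ (N G w ∩ D) ∪ ⁅ v₀ ⁆
        N[vᵣ]∩D⊆ {u} u∈ with x∈p∩q⁻ (N G vᵣ) D u∈
        ... | u∈N , u∈D with adj⇒Adj {vᵣ} {u} (∈N⇒adj G u∈N)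
        ... | inj₁ (r≡0 , _)          = contradiction (trans (sym toℕ-vᵣ) r≡0) λ ()
        ... | inj₂ (inj₁ (_ , u≡0))   = x∈p∪q⁺ (inj₂ (subst (_∈ ⁅ v₀ ⁆) (sym (toℕ-injective u≡0)) (x∈⁅x⁆ v₀)))
        ... | inj₂ (inj₂ (_ , n≤r+u)) = x∈p∪q⁺ (inj₁ (x∈p∩q⁺ (adj⇒∈N G (far⇒adj (∉∈⇒toℕ≢ w∉D u∈D) n≤w+u) , u∈D)))
          where
          n≤w+u : order ≤ toℕ w + toℕ u
          n≤w+u = ≤-trans n≤r+u (+-monoˡ-≤ (toℕ u) (subst (_≤ toℕ w) (sym toℕ-vᵣ) (≤-trans (m≤n+m r 3) 3+r≤w)))

      2+r≤r+r : 2 + r ≤ r + r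
      2+r≤r+r = +-monoˡ-≤ r {2} {r} (s≤s (s≤s z≤n))

      outside : ∀ {w} → w ∉ D → w ≡ vᵣ ⊎ w ≡ vertex (2 + r) 2+r≤r+r
      outside {w} w∉D with <-cmp (toℕ w) r
      ... | tri< w<r _ _ = contradiction (<r⇒∈ (∉⇒≢0 w∉D) w<r) w∉D
      ... | tri≈ _ w≡r _ = inj₁ (toℕ-injective (trans w≡r (sym toℕ-vᵣ)))
      ... | tri> _ _ r<w with toℕ w ≟ 1 + r | toℕ w ≟ 2 + r
      ...   | yes w≡1+r | _         = ⊥-elim (≡1+r⇒∉⇒⊥ w∉D w≡1+r)
      ...   | no _      | yes w≡2+r = inj₂ (toℕ-injective (trans w≡2+r (sym (toℕ-vertex (2 + r) 2+r≤r+r))))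
      ...   | no w≢1+r  | no w≢2+r  = ⊥-elim (3+r≤⇒∉⇒⊥ w∉D (≤∧≢⇒< (≤∧≢⇒< r<w (w≢1+r ∘ sym)) (w≢2+r ∘ sym)))

    module Case-v₀∉D (v₀∉D : v₀ ∉ D) where

      vᵣ∈D : vᵣ ∈ D
      vᵣ∈D with dom v₀ v₀∉D
      ... | u , u∈D , v₀~u = subst (_∈ D) (v₀-adj⇒≡vᵣ v₀~u) u∈D

      k≤1 : k ≤ 1
      k≤1 = subst (_≤ 1) (fair v₀ v₀∉D) (subst (∣ N G v₀ ∩ D ∣ ≤_) (∣⁅x⁆∣≡1 vᵣ) (p⊆q⇒∣p∣≤∣q∣ N[v₀]∩D⊆⁅vᵣ⁆))
        where
        N[v₀]∩D⊆⁅vᵣ⁆ : N G v₀ ∩ D ⊆ ⁅ vᵣ ⁆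
        N[v₀]∩D⊆⁅vᵣ⁆ u∈ = subst (_∈ ⁅ vᵣ ⁆) (sym (v₀-adj⇒≡vᵣ (∈N⇒adj G (proj₁ (x∈p∩q⁻ (N G v₀) D u∈))))) (x∈⁅x⁆ vᵣ)

      one-D-neighbour : ∀ {x u w} → x ∉ D → u ∈ D → w ∈ D → adj G x u ≡ true → adj G x w ≡ true → u ≡ w
      one-D-neighbour x∉D u∈D w∈D x~u x~w = decidable-stable (_ ≟ᶠ _) λ u≢w →
        ≤⇒≯ k≤1 (fair-two-neighbours⇒2≤k G fair x∉D u∈D w∈D u≢w x~u x~w)

      vᵣ≢v₂ᵣ : vᵣ ≢ v₂ᵣ
      vᵣ≢v₂ᵣ vᵣ≡v₂ᵣ = <⇒≢ (m<m+n r {r} (s≤s z≤n)) (trans (sym toℕ-vᵣ) (trans (cong toℕ vᵣ≡v₂ᵣ) toℕ-v₂ᵣ))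

      v₂ᵣ∈D : v₂ᵣ ∈ D
      v₂ᵣ∈D with v₂ᵣ ∈? D | v₁ ∈? D
      ... | yes v₂ᵣ∈D | _ = v₂ᵣ∈D
      ... | no v₂ᵣ∉D | yes v₁∈D = contradiction
              (one-D-neighbour v₂ᵣ∉D vᵣ∈D v₁∈D (r<⇒adj-vᵣ (subst (r <_) (sym toℕ-v₂ᵣ) (m<m+n r (s≤s z≤n))))
                 (trans (Graph.sym G v₂ᵣ v₁) (≢0⇒adj-v₂ᵣ {v₁} (λ ()) (λ ()))))
              λ vᵣ≡v₁ → contradiction (trans (sym toℕ-vᵣ) (cong toℕ vᵣ≡v₁)) λ ()
      ... | no v₂ᵣ∉D | no v₁∉D with dom v₁ v₁∉D
      ...   | u , u∈D , v₁~u = contradiction (subst (_∈ D) (v₁-adj⇒≡v₂ᵣ v₁~u) u∈D) v₂ᵣ∉D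

      ∉⇒≢2r : ∀ {w} → w ∉ D → toℕ w ≢ r + r
      ∉⇒≢2r w∉D w≡2r = ∉∈⇒toℕ≢ w∉D v₂ᵣ∈D (trans w≡2r (sym toℕ-v₂ᵣ))

      r<⇒∉⇒⊥ : ∀ {w} → w ∉ D → r < toℕ w → ⊥
      r<⇒∉⇒⊥ w∉D r<w = vᵣ≢v₂ᵣ (one-D-neighbour w∉D vᵣ∈D v₂ᵣ∈D (r<⇒adj-vᵣ r<w)
        (≢0⇒adj-v₂ᵣ (<⇒≢ (≤-<-trans z≤n r<w) ∘ sym) (∉⇒≢2r w∉D)))

      outside : ∀ {w} → w ∉ D → w ≡ v₀ ⊎ w ≡ v₁
      outside {w} w∉D with toℕ w ≟ 0 | toℕ w ≟ 1
      ... | yes w≡0 | _       = inj₁ (toℕ-injective w≡0)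
      ... | no _    | yes w≡1 = inj₂ (toℕ-injective w≡1)
      ... | no w≢0  | no w≢1 with partner w w≢0
      ...   | z , z+w≡n with z ∈? D
      ...     | yes z∈D = ⊥-elim (w≢1 (2r+b≡order⇒b≡1 (trans (cong (_+ toℕ w) (sym z≡2r)) z+w≡n)))
        where
        w~z : adj G w z ≡ true
        w~z = far⇒adj (∉∈⇒toℕ≢ w∉D z∈D) (≤-reflexive (trans (sym z+w≡n) (+-comm (toℕ z) (toℕ w))))
        z≡2r : toℕ z ≡ r + r
        z≡2r = trans (cong toℕ (one-D-neighbour w∉D z∈D v₂ᵣ∈D w~z (≢0⇒adj-v₂ᵣ w≢0 (∉⇒≢2r w∉D)))) toℕ-v₂ᵣ
      ...     | no z∉D with toℕ z ≤? r
      ...       | yes z≤r = ⊥-elim (r<⇒∉⇒⊥ w∉D (≤r⇒r<partner z+w≡n z≤r))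
      ...       | no z≰r  = ⊥-elim (r<⇒∉⇒⊥ z∉D (≰⇒> z≰r))

    lower-bound : order ∸ 2 ≤ ∣ D ∣
    lower-bound with v₀ ∈? D | vᵣ ∈? D
    ... | yes v₀∈D | yes vᵣ∈D = ∉-unique⇒n∸2≤∣p∣ (Case-v₀∈D∧vᵣ∈D.∉-unique v₀∈D vᵣ∈D)
    ... | yes v₀∈D | no vᵣ∉D  = ∉⇒≡⊎≡⇒n∸2≤∣p∣ _ _ (λ _ → Case-v₀∈D∧vᵣ∉D.outside v₀∈D vᵣ∉D)
    ... | no v₀∉D  | _        = ∉⇒≡⊎≡⇒n∸2≤∣p∣ _ _ (λ _ → Case-v₀∉D.outside v₀∉D)

  minDeg≥1 : MinDeg≥1 G
  minDeg≥1 v with toℕ v ≟ 0 | toℕ v ≟ r + r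
  ... | yes v≡0 | _ = vᵣ , Adj⇒adj (inj₁ (v≡0 , toℕ-vᵣ))
  ... | no v≢0 | yes v≡2r = v₁ , far⇒adj (λ v≡1 → contradiction (trans (sym v≡2r) v≡1) λ ())
                                        (subst (λ c → order ≤ c + 1) (sym v≡2r) (≤-reflexive (+-comm 1 (r + r))))
  ... | no v≢0 | no v≢2r = v₂ᵣ , ≢0⇒adj-v₂ᵣ v≢0 v≢2r

  fairDom⇒order∸2≤ : ∀ D → FairDom G D → order ∸ 2 ≤ ∣ D ∣
  fairDom⇒order∸2≤ D (_ , _ , dom , fair) = LowerBound.lower-bound dom fair

  fd≡order∸2 : FdEq G (order ∸ 2)
  fd≡order∸2 = fdLe+lowerBound⇒fdEq G (minDeg≥1⇒fdLe G (s≤s (s≤s (s≤s z≤n))) minDeg≥1) fairDom⇒order∸2≤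

  s≤order : s ≤ order
  s≤order = ≤-trans (m≤n+m s 3) (≤-trans (m≤m+n r r) (n≤1+n (r + r)))

theorem2 : ((n : ℕ) → 3 ≤ n → (G : Graph n) → MinDeg≥1 G → FdLe G (n ∸ 2))
         × ((m : ℕ) → ∃[ n ] (m ≤ n × Σ (Graph n) (λ G → MinDeg≥1 G × FdEq G (n ∸ 2))))
theorem2 = (λ n 3≤n G → minDeg≥1⇒fdLe G 3≤n) ,
           λ m → let open Extremal m in order , s≤order , G , minDeg≥1 , fd≡order∸2
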